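{- For $n\ge 4$, every non-negative integer occurs as a coordinate of some $n$-color fair game, i.e. of some tuple $(x_1,\dots,x_n)$ of non-negative integers satisfying $\left(\sum_i x_i\right)^2-\sum_i x_i-4\sum_{1\le i<j\le n}x_ix_j=0$. That is, $\mathcal{C}_n=\mathbb{Z}_{\ge 0}$, where $\mathcal{C}_n$ is the set of coordinates of $n$-color fair games. -}

module Defs where

open import Data.Nat using (ℕ; zero; suc; _+_; _*_; _<_)
open import Data.Fin using (Fin; toℕ)
open import Data.Product using (∃; ∃-syntax; _,_; _×_)
open import Relation.Binary.PropositionalEquality using (_≡_)

sumFin : ∀ n → (Fin n → ℕ) → ℕ
sumFin zero    f = 0
sumFin (suc n) f = f Data.Fin.zero + sumFin n (λ i → f (Data.Fin.suc i))

pairSum : ∀ n → (Fin n → ℕ) → ℕ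
pairSum zero    x = 0
pairSum (suc n) x = x Data.Fin.zero * sumFin n (λ j → x (Data.Fin.suc j))
                  + pairSum n (λ i → x (Data.Fin.suc i))

-- x is an n-color fair game: (Σ x_i)^2 - Σ x_i - 4 Σ_{i<j} x_i x_j = 0,
-- rearranged over ℕ (no subtraction) as (Σ x_i)^2 = Σ x_i + 4 Σ_{i<j} x_i x_j.
IsFairGame : ∀ n → (Fin n → ℕ) → Set
IsFairGame n x = sumFin n x * sumFin n x ≡ sumFin n x + 4 * pairSum n x

IsCoordinate : ℕ → ℕ → Set
IsCoordinate n m = ∃[ x ] (IsFairGame n x × ∃[ i ] (x i ≡ m))

-- For every m the four-color game (m, 2m², 2m², 8m² + 3m + 1) is fair, which is
-- a polynomial identity in m. Appending colors with no balls changes neither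
-- the total nor the pair sum, so padding it with zeros works for every n ≥ 4.
module Submission where

open import Defs
open import Data.Nat using (ℕ; zero; suc; _+_; _*_; _≤_)
open import Data.Nat.Properties using (m≤n⇒∃[o]m+o≡n)
open import Data.Nat.Tactic.RingSolver using (solve-∀)
open import Data.Fin using (Fin)
open import Data.Product using (_,_)
open import Function using (_∘_)
open import Relation.Binary.PropositionalEquality using (_≡_; refl; cong; cong₂)

sumFin-zeros : ∀ k → sumFin k (λ _ → 0) ≡ 0
sumFin-zeros zero    = refl
sumFin-zeros (suc k) = sumFin-zeros k

pairSum-zeros : ∀ k → pairSum k (λ _ → 0) ≡ 0
pairSum-zeros zero    = refl
pairSum-zeros (suc k) = pairSum-zeros k

padZeros : ∀ {n} k → (Fin n → ℕ) → Fin (n + k) → ℕ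
padZeros {zero}  k x i           = 0
padZeros {suc n} k x Fin.zero    = x Fin.zero
padZeros {suc n} k x (Fin.suc i) = padZeros k (x ∘ Fin.suc) i

sumFin-padZeros : ∀ n k (x : Fin n → ℕ) → sumFin (n + k) (padZeros k x) ≡ sumFin n x
sumFin-padZeros zero    k x = sumFin-zeros k
sumFin-padZeros (suc n) k x = cong (x Fin.zero +_) (sumFin-padZeros n k (x ∘ Fin.suc))

pairSum-padZeros : ∀ n k (x : Fin n → ℕ) → pairSum (n + k) (padZeros k x) ≡ pairSum n x
pairSum-padZeros zero    k x = pairSum-zeros k
pairSum-padZeros (suc n) k x =
  cong₂ (λ s p → x Fin.zero * s + p)
        (sumFin-padZeros n k (x ∘ Fin.suc))
        (pairSum-padZeros n k (x ∘ Fin.suc))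

isFairGame-padZeros : ∀ n k (x : Fin n → ℕ) → IsFairGame n x → IsFairGame (n + k) (padZeros k x)
isFairGame-padZeros n k x fair
  rewrite sumFin-padZeros n k x | pairSum-padZeros n k x = fair

fourColorGame : ℕ → Fin 4 → ℕ
fourColorGame m Fin.zero                               = m
fourColorGame m (Fin.suc Fin.zero)                     = 2 * (m * m)
fourColorGame m (Fin.suc (Fin.suc Fin.zero))           = 2 * (m * m)
fourColorGame m (Fin.suc (Fin.suc (Fin.suc Fin.zero))) = 8 * (m * m) + 3 * m + 1

isFairGame-fourColorGame : ∀ m → IsFairGame 4 (fourColorGame m)
isFairGame-fourColorGame m = fairness-identity m
  where
  fairness-identity : ∀ m → let a = 2 * (m * m); c = 8 * (m * m) + 3 * m + 1
                                s = m + (a + (a + (c + 0))) in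
                      s * s ≡ s + 4 * (m * (a + (a + (c + 0)))
                                      + (a * (a + (c + 0)) + (a * (c + 0) + (c * 0 + 0))))
  fairness-identity = solve-∀

isCoordinate-4+ : ∀ k m → IsCoordinate (4 + k) m
isCoordinate-4+ k m =
  padZeros k (fourColorGame m) ,
  isFairGame-padZeros 4 k (fourColorGame m) (isFairGame-fourColorGame m) ,
  Fin.zero , refl

proposition5p1 : ∀ (n : ℕ) → 4 ≤ n → ∀ (m : ℕ) → IsCoordinate n m
proposition5p1 n 4≤n m with m≤n⇒∃[o]m+o≡n 4≤n
... | k , refl = isCoordinate-4+ k m
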